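{- If $r\ge 2$ and $t\ge 1$, then $6\le {\rm gp}(P_r\boxtimes C_{2t+1})\le 7$. Moreover, if $t\in \{1,2\}$ or $r=2$, then ${\rm gp}(P_r\boxtimes C_{2t+1})=6$.
   Context: All graphs are finite and simple; $P_r$ is the path on $r$ vertices and $C_m$ the cycle on $m$ vertices. The strong product $G\boxtimes H$ has vertex set $V(G)\times V(H)$, with distinct $(g,h),(g',h')$ adjacent iff ($g=g'$ or $gg'\in E(G)$) and ($h=h'$ or $hh'\in E(H)$). For a connected graph $X$, a set $S\subseteq V(X)$ is a general position set if no three pairwise distinct vertices of $S$ lie on a common geodesic of $X$; ${\rm gp}(X)$ is the maximum cardinality of a general position set. -}

module Defs where

open import Level using (0ℓ)
open import Data.Nat using (ℕ; zero; suc; _+_; _≤_; _%_)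
open import Data.Nat.Properties using ()
open import Data.Fin using (Fin; toℕ)
open import Data.Product using (_×_; _,_; Σ; ∃; ∃-syntax; proj₁; proj₂)
open import Data.Sum using (_⊎_)
open import Data.List using (List; []; _∷_; length)
open import Data.List.Membership.Propositional using (_∈_)
open import Data.List.Relation.Unary.Unique.Propositional using (Unique)
open import Relation.Binary.PropositionalEquality using (_≡_; _≢_)
open import Relation.Nullary using (¬_)

-- A (finite simple) graph: vertex type and an adjacency relation
-- (the concrete graphs below have finite vertex types Fin r × Fin m,
-- irreflexive and symmetric adjacency).
record Graph : Set₁ where
  field
    V   : Set
    Adj : V → V → Set
open Graph public

Path : ℕ → Graph
V (Path r) = Fin r
Adj (Path r) i j = (suc (toℕ i) ≡ toℕ j) ⊎ (suc (toℕ j) ≡ toℕ i)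

-- Cycle C_m on vertices 0,…,m-1 : i ~ j iff |i - j| = 1, or {i,j} = {0, m-1}
-- (used for m = 2t+1 ≥ 3, where this is the simple m-cycle)
Cycle : (m : ℕ) → Graph
V (Cycle m) = Fin m
Adj (Cycle m) i j =
  (suc (toℕ i) ≡ toℕ j) ⊎ (suc (toℕ j) ≡ toℕ i) ⊎
  ((toℕ i ≡ 0) × (suc (toℕ j) ≡ m)) ⊎ ((toℕ j ≡ 0) × (suc (toℕ i) ≡ m))

_⊠_ : Graph → Graph → Graph
V (G ⊠ H) = V G × V H
Adj (G ⊠ H) (g , h) (g' , h') =
  ((g , h) ≢ (g' , h')) ×
  ((g ≡ g') ⊎ Adj G g g') ×
  ((h ≡ h') ⊎ Adj H h h')

data Walk (G : Graph) : V G → V G → Set where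
  [_]  : (x : V G) → Walk G x x
  _∷ʷ_ : ∀ {x y z} → Adj G x y → Walk G y z → Walk G x z

walkLength : ∀ {G x y} → Walk G x y → ℕ
walkLength [ _ ]      = 0
walkLength (_ ∷ʷ w)   = suc (walkLength w)

walkVertices : ∀ {G x y} → Walk G x y → List (V G)
walkVertices [ x ] = x ∷ []
walkVertices {x = x} (_ ∷ʷ w) = x ∷ walkVertices w

IsGeodesic : ∀ {G x y} → Walk G x y → Set
IsGeodesic {G} {x} {y} w = ∀ (w' : Walk G x y) → walkLength w ≤ walkLength w'

OnCommonGeodesic : (G : Graph) → V G → V G → V G → Set
OnCommonGeodesic G u v w =
  Σ (V G) λ x → Σ (V G) λ y → Σ (Walk G x y) λ p →
    IsGeodesic p × (u ∈ walkVertices p) × (v ∈ walkVertices p) × (w ∈ walkVertices p)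

-- general position set (a finite set given as a duplicate-free list)
IsGPSet : (G : Graph) → List (V G) → Set
IsGPSet G S =
  Unique S ×
  (∀ {u v w} → u ∈ S → v ∈ S → w ∈ S → u ≢ v → v ≢ w → u ≢ w →
     ¬ OnCommonGeodesic G u v w)

GpNumber : Graph → ℕ → Set
GpNumber G k =
  (Σ (List (V G)) λ S → IsGPSet G S × length S ≡ k) ×
  (∀ (S : List (V G)) → IsGPSet G S → length S ≤ k)

-- We prove the sharper statement gp(P_r ⊠ C_{2t+1}) = 6, from which both parts of
-- the theorem follow at once.  The argument works with explicit distance functions:
-- a function d is the distance of a graph if it bounds every walk length from below
-- and is attained by a walk.  Then three vertices lie on a common geodesic exactly
-- when one of them is between the other two (d a b + d b c ≤ d a c), so general
-- position can be checked by arithmetic.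
-- Upper bound: in a general position set S of P_r ⊠ C_m, call y in the cone of x if
-- y is at least as many rows above x as it is away from x on the cycle.  The
-- vertices of S having another vertex of S in their cone, and the remaining ones,
-- form two sets in which no vertex is in the cone of another; there the distance is
-- the cycle distance, and four points on a cycle always contain a betweenness, so
-- each part has at most three vertices.  Lower bound: rows 0, 1 at positions
-- 0, 1, t + 1 of C_{2t+1} give six vertices in general position.

module Submission where

open import Defs
open import Data.Nat using (ℕ; zero; suc; _+_; _*_; _≤_; _≥_; _<_; _∸_; _⊓_; _⊔_; ∣_-_∣; z≤n; s≤s; _≤?_)
open import Data.Nat.Properties
open import Data.Fin using (Fin; zero; suc; toℕ; fromℕ<; fromℕ)
import Data.Fin as Fin
open import Data.Fin.Properties using (toℕ-injective; toℕ<n; toℕ-fromℕ<; toℕ-fromℕ)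
open import Data.Product
open import Data.Product.Properties using (≡-dec)
open import Data.Sum using (_⊎_; inj₁; inj₂; [_,_]′)
import Data.Sum as Sum
open import Data.List using (List; []; _∷_; length; filter; cartesianProduct)
open import Data.List.Membership.Propositional using (_∈_; find; lose)
open import Data.List.Membership.Propositional.Properties using (∈-filter⁻; ∈-cartesianProduct⁻)
open import Data.List.Relation.Unary.Any using (Any; here; there; any?)
open import Data.List.Relation.Unary.Linked using (Linked; _∷_)
open import Data.List.Relation.Unary.AllPairs using ([]; _∷_)
open import Data.List.Relation.Unary.All using ([]; _∷_)
open import Data.List.Relation.Unary.Unique.Propositional using (Unique)
open import Data.List.Relation.Unary.Unique.Propositional.Properties using (filter⁺; cartesianProduct⁺)
open import Data.List.Relation.Binary.Permutation.Propositional using (↭-sym; ↭⇒↭ₛ)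
open import Data.List.Relation.Binary.Permutation.Propositional.Properties using (↭-length; ∈-resp-↭)
import Data.List.Relation.Binary.Permutation.Setoid.Properties as PermutationProperties
import Data.List.Sort as Sort
open import Data.Empty using (⊥-elim)
open import Function using (_∘_)
open import Relation.Binary.Definitions using (DecidableEquality)
import Relation.Binary.Construct.On as On
open import Relation.Binary.PropositionalEquality
open import Relation.Nullary
open import Relation.Unary using (Decidable)

module _ {G : Graph} where

  infixr 5 _++ʷ_

  _++ʷ_ : ∀ {x y z} → Walk G x y → Walk G y z → Walk G x z
  [ _ ]    ++ʷ q = q
  (e ∷ʷ p) ++ʷ q = e ∷ʷ (p ++ʷ q)

  length-++ʷ : ∀ {x y z} (p : Walk G x y) (q : Walk G y z) →
    walkLength (p ++ʷ q) ≡ walkLength p + walkLength q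
  length-++ʷ [ _ ]    q = refl
  length-++ʷ (e ∷ʷ p) q = cong suc (length-++ʷ p q)

  start∈ : ∀ {x y} (p : Walk G x y) → x ∈ walkVertices p
  start∈ [ x ]    = here refl
  start∈ (e ∷ʷ p) = here refl

  end∈ : ∀ {x y} (p : Walk G x y) → y ∈ walkVertices p
  end∈ [ x ]    = here refl
  end∈ (e ∷ʷ p) = there (end∈ p)

  ∈-++ʷʳ : ∀ {x y z} (p : Walk G x y) (q : Walk G y z) {v} →
    v ∈ walkVertices q → v ∈ walkVertices (p ++ʷ q)
  ∈-++ʷʳ [ _ ]    q v∈q = v∈q
  ∈-++ʷʳ (e ∷ʷ p) q v∈q = there (∈-++ʷʳ p q v∈q)

  reverseʷ : (∀ {x y} → Adj G x y → Adj G y x) →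
    ∀ {x y} (p : Walk G x y) → Σ (Walk G y x) λ q → walkLength q ≡ walkLength p
  reverseʷ sym-adj [ x ] = [ x ] , refl
  reverseʷ sym-adj {x} (e ∷ʷ p) =
    let (q , ∣q∣) = reverseʷ sym-adj p
        back      = sym-adj e ∷ʷ [ x ]
    in q ++ʷ back , trans (length-++ʷ q back) (trans (+-comm (walkLength q) 1) (cong suc ∣q∣))

  record Cut {x y} (p : Walk G x y) (z : V G) : Set where
    field
      prefix : Walk G x z
      suffix : Walk G z y
      length-cut : walkLength prefix + walkLength suffix ≡ walkLength p
      covers : ∀ {v} → v ∈ walkVertices p →
        v ∈ walkVertices prefix ⊎ v ∈ walkVertices suffix
  open Cut

  cut : ∀ {x y} (p : Walk G x y) {z} → z ∈ walkVertices p → Cut p z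
  cut [ x ] (here refl) = record
    { prefix = [ x ] ; suffix = [ x ] ; length-cut = refl ; covers = inj₁ }
  cut (e ∷ʷ p) (here refl) = record
    { prefix = [ _ ] ; suffix = e ∷ʷ p ; length-cut = refl ; covers = inj₂ }
  cut (e ∷ʷ p) (there z∈p) = record
    { prefix = e ∷ʷ prefix c ; suffix = suffix c ; length-cut = cong suc (length-cut c)
    ; covers = λ { (here refl) → inj₁ (here refl)
                 ; (there v∈p) → Sum.map₁ there (covers c v∈p) } }
    where c = cut p z∈p

  record Through₂ {x y} (p : Walk G x y) (a b : V G) : Set where
    field
      piece₀ : Walk G x a
      piece₁ : Walk G a b
      piece₂ : Walk G b y
      length₂ : walkLength piece₀ + walkLength piece₁ + walkLength piece₂ ≡ walkLength p
      covers₂ : ∀ {v} → v ∈ walkVertices p → v ∈ walkVertices piece₀ ⊎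
        v ∈ walkVertices piece₁ ⊎ v ∈ walkVertices piece₂
  open Through₂

  record Through₃ {x y} (p : Walk G x y) (a b c : V G) : Set where
    field
      leg₀ : Walk G x a
      leg₁ : Walk G a b
      leg₂ : Walk G b c
      leg₃ : Walk G c y
      length₃ : walkLength leg₀ + walkLength leg₁ + walkLength leg₂ + walkLength leg₃
                ≡ walkLength p
  open Through₃ public

  order₂ : ∀ {x y} (p : Walk G x y) {a b} → a ∈ walkVertices p → b ∈ walkVertices p →
    Through₂ p a b ⊎ Through₂ p b a
  order₂ p a∈p b∈p with cut p a∈p
  ... | c with covers c b∈p
  ... | inj₂ b∈suffix = inj₁ (record
          { piece₀ = prefix c ; piece₁ = prefix c' ; piece₂ = suffix c'
          ; length₂ = trans (+-assoc (walkLength (prefix c)) _ _)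
                        (trans (cong (walkLength (prefix c) +_) (length-cut c')) (length-cut c))
          ; covers₂ = λ v∈p → Sum.map₂ (covers c') (covers c v∈p) })
    where c' = cut (suffix c) b∈suffix
  ... | inj₁ b∈prefix = inj₂ (record
          { piece₀ = prefix c' ; piece₁ = suffix c' ; piece₂ = suffix c
          ; length₂ = trans (cong (_+ walkLength (suffix c)) (length-cut c')) (length-cut c)
          ; covers₂ = λ v∈p → [ (λ v∈pre → Sum.map₂ inj₁ (covers c' v∈pre)) , (λ v∈suf → inj₂ (inj₂ v∈suf)) ]′
                                (covers c v∈p) })
    where c' = cut (prefix c) b∈prefix

  order₃ : ∀ {x y} (p : Walk G x y) {a b c} → Through₂ p a b → c ∈ walkVertices p →
    Through₃ p c a b ⊎ Through₃ p a c b ⊎ Through₃ p a b c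
  order₃ p {a} {b} {c} t c∈p = place (covers₂ t c∈p)
    where
      ℓ₀ = walkLength (piece₀ t)
      ℓ₁ = walkLength (piece₁ t)
      ℓ₂ = walkLength (piece₂ t)
      place : c ∈ walkVertices (piece₀ t) ⊎ c ∈ walkVertices (piece₁ t) ⊎ c ∈ walkVertices (piece₂ t) →
        Through₃ p c a b ⊎ Through₃ p a c b ⊎ Through₃ p a b c
      place (inj₁ c∈p₀) = inj₁ (record
        { leg₀ = prefix k ; leg₁ = suffix k ; leg₂ = piece₁ t ; leg₃ = piece₂ t
        ; length₃ = trans (cong (λ n → n + ℓ₁ + ℓ₂) (length-cut k)) (length₂ t) })
        where k = cut (piece₀ t) c∈p₀
      place (inj₂ (inj₁ c∈p₁)) = inj₂ (inj₁ (record
        { leg₀ = piece₀ t ; leg₁ = prefix k ; leg₂ = suffix k ; leg₃ = piece₂ t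
        ; length₃ = trans (cong (_+ ℓ₂) (trans (+-assoc ℓ₀ _ _) (cong (ℓ₀ +_) (length-cut k))))
                      (length₂ t) }))
        where k = cut (piece₁ t) c∈p₁
      place (inj₂ (inj₂ c∈p₂)) = inj₂ (inj₂ (record
        { leg₀ = piece₀ t ; leg₁ = piece₁ t ; leg₂ = prefix k ; leg₃ = suffix k
        ; length₃ = trans (trans (+-assoc (ℓ₀ + ℓ₁) _ _) (cong (ℓ₀ + ℓ₁ +_) (length-cut k)))
                      (length₂ t) }))
        where k = cut (piece₂ t) c∈p₂

Between : {A : Set} → (A → A → ℕ) → A → A → A → Set
Between d a b c = d a b + d b c ≤ d a c

record IsDistance (G : Graph) (d : V G → V G → ℕ) : Set where
  field
    ≤-walk   : ∀ {x y} (w : Walk G x y) → d x y ≤ walkLength w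
    shortest : ∀ x y → Σ (Walk G x y) λ w → walkLength w ≤ d x y

  d-refl : ∀ x → d x x ≡ 0
  d-refl x = n≤0⇒n≡0 (≤-walk [ x ])

  d-step : ∀ {x x'} → Adj G x x' → ∀ y → d x y ≤ suc (d x' y)
  d-step e y = let (w , ∣w∣≤) = shortest _ y in ≤-trans (≤-walk (e ∷ʷ w)) (s≤s ∣w∣≤)

  d-positive : ∀ {x y} → x ≢ y → 1 ≤ d x y
  d-positive {x} {y} x≢y with d x y | shortest x y
  ... | zero  | [ _ ] , _ = ⊥-elim (x≢y refl)
  ... | suc _ | _         = s≤s z≤n

  between-distinct : ∀ {a b c} → Between d a b c → a ≢ b → a ≢ c
  between-distinct {a} {b} abc a≢b refl =
    1+n≰n (subst (1 ≤_) (d-refl a) (≤-trans (d-positive a≢b) (≤-trans (m≤m+n _ _) abc)))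

distance-by-steps : ∀ {G d} → (∀ x → d x x ≡ 0) →
  (∀ {x x'} → Adj G x x' → ∀ y → d x y ≤ suc (d x' y)) →
  (∀ x y → Σ (Walk G x y) λ w → walkLength w ≤ d x y) → IsDistance G d
distance-by-steps {G} {d} zero-diag step attained = record
  { ≤-walk = bound ; shortest = attained }
  where
    bound : ∀ {x y} (w : Walk G x y) → d x y ≤ walkLength w
    bound {x} [ _ ]      = ≤-reflexive (zero-diag x)
    bound {y = y} (e ∷ʷ w) = ≤-trans (step e y) (s≤s (bound w))


module _ {G : Graph} {d : V G → V G → ℕ} (dist : IsDistance G d) where
  open IsDistance dist

  -- A shortest a–b walk followed by a shortest b–c walk is a geodesic.
  between⇒common-geodesic : ∀ {a b c} → Between d a b c → OnCommonGeodesic G a b c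
  between⇒common-geodesic {a} {b} {c} abc =
    a , c , w₁ ++ʷ w₂ , geodesic , start∈ (w₁ ++ʷ w₂) , ∈-++ʷʳ w₁ w₂ (start∈ w₂) , ∈-++ʷʳ w₁ w₂ (end∈ w₂)
    where
      w₁ = proj₁ (shortest a b)
      w₂ = proj₁ (shortest b c)
      geodesic : IsGeodesic (w₁ ++ʷ w₂)
      geodesic w = begin
        walkLength (w₁ ++ʷ w₂)         ≡⟨ length-++ʷ w₁ w₂ ⟩
        walkLength w₁ + walkLength w₂  ≤⟨ +-mono-≤ (proj₂ (shortest a b)) (proj₂ (shortest b c)) ⟩
        d a b + d b c                  ≤⟨ abc ⟩
        d a c                          ≤⟨ ≤-walk w ⟩
        walkLength w                   ∎
        where open ≤-Reasoning

  -- Three vertices visited in order a, b, c by a geodesic: b is between a and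
  -- c, since replacing the middle section by a shortest a–c walk cannot help.
  through⇒between : ∀ {x y} (p : Walk G x y) → IsGeodesic p → ∀ {a b c} →
    Through₃ p a b c → Between d a b c
  through⇒between p geodesic {a} {b} {c} t = begin
    d a b + d b c  ≤⟨ +-mono-≤ (≤-walk (leg₁ t)) (≤-walk (leg₂ t)) ⟩
    ℓ₁ + ℓ₂        ≤⟨ +-cancelʳ-≤ ℓ₃ _ _ (+-cancelˡ-≤ ℓ₀ _ _ detour) ⟩
    ∣s∣            ≤⟨ proj₂ (shortest a c) ⟩
    d a c          ∎
    where
      open ≤-Reasoning
      s = proj₁ (shortest a c)
      ∣s∣ = walkLength s
      ℓ₀ = walkLength (leg₀ t)
      ℓ₁ = walkLength (leg₁ t)
      ℓ₂ = walkLength (leg₂ t)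
      ℓ₃ = walkLength (leg₃ t)
      detour : ℓ₀ + (ℓ₁ + ℓ₂ + ℓ₃) ≤ ℓ₀ + (∣s∣ + ℓ₃)
      detour = begin
        ℓ₀ + (ℓ₁ + ℓ₂ + ℓ₃)                       ≡⟨ sym (trans (+-assoc (ℓ₀ + ℓ₁) ℓ₂ ℓ₃)
                                                      (trans (+-assoc ℓ₀ ℓ₁ (ℓ₂ + ℓ₃))
                                                        (cong (ℓ₀ +_) (sym (+-assoc ℓ₁ ℓ₂ ℓ₃))))) ⟩
        ℓ₀ + ℓ₁ + ℓ₂ + ℓ₃                         ≡⟨ length₃ t ⟩
        walkLength p                              ≤⟨ geodesic (leg₀ t ++ʷ (s ++ʷ leg₃ t)) ⟩
        walkLength (leg₀ t ++ʷ (s ++ʷ leg₃ t)) ≡⟨ length-++ʷ (leg₀ t) (s ++ʷ leg₃ t) ⟩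
        ℓ₀ + walkLength (s ++ʷ leg₃ t)          ≡⟨ cong (ℓ₀ +_) (length-++ʷ s (leg₃ t)) ⟩
        ℓ₀ + (∣s∣ + ℓ₃)                           ∎

  gp-set-by-betweenness : ∀ (S : List (V G)) → Unique S →
    (∀ {a b c} → a ∈ S → b ∈ S → c ∈ S → a ≢ b → b ≢ c → a ≢ c → ¬ Between d a b c) →
    IsGPSet G S
  gp-set-by-betweenness S unique no-between = unique , no-common-geodesic
    where
      no-common-geodesic : ∀ {u v w} → u ∈ S → v ∈ S → w ∈ S → u ≢ v → v ≢ w → u ≢ w →
        ¬ OnCommonGeodesic G u v w
      no-common-geodesic u∈S v∈S w∈S u≢v v≢w u≢w (x , y , p , geodesic , u∈p , v∈p , w∈p)
        with order₂ p u∈p v∈p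
      ... | inj₁ uv with order₃ p uv w∈p
      ...   | inj₁ wuv        = no-between w∈S u∈S v∈S (≢-sym u≢w) u≢v (≢-sym v≢w)
                                  (through⇒between p geodesic wuv)
      ...   | inj₂ (inj₁ uwv) = no-between u∈S w∈S v∈S u≢w (≢-sym v≢w) u≢v
                                  (through⇒between p geodesic uwv)
      ...   | inj₂ (inj₂ uvw) = no-between u∈S v∈S w∈S u≢v v≢w u≢w
                                  (through⇒between p geodesic uvw)
      no-common-geodesic u∈S v∈S w∈S u≢v v≢w u≢w (x , y , p , geodesic , u∈p , v∈p , w∈p)
          | inj₂ vu with order₃ p vu w∈p
      ...   | inj₁ wvu        = no-between w∈S v∈S u∈S (≢-sym v≢w) (≢-sym u≢v) (≢-sym u≢w)
                                  (through⇒between p geodesic wvu)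
      ...   | inj₂ (inj₁ vwu) = no-between v∈S w∈S u∈S v≢w (≢-sym u≢w) (≢-sym u≢v)
                                  (through⇒between p geodesic vwu)
      ...   | inj₂ (inj₂ vuw) = no-between v∈S u∈S w∈S (≢-sym u≢v) u≢w v≢w
                                  (through⇒between p geodesic vuw)

  gp-set⇒no-between : ∀ {S} → IsGPSet G S → ∀ {a b c} → a ∈ S → b ∈ S → c ∈ S →
    a ≢ b → b ≢ c → a ≢ c → ¬ Between d a b c
  gp-set⇒no-between (_ , gp) a∈S b∈S c∈S a≢b b≢c a≢c abc =
    gp a∈S b∈S c∈S a≢b b≢c a≢c (between⇒common-geodesic abc)

Irreflexive : Graph → Set
Irreflexive G = ∀ {x} → ¬ Adj G x x

stay-or-step : ∀ {G d} → IsDistance G d → ∀ {x x'} → (x ≡ x' ⊎ Adj G x x') →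
  ∀ y → d x y ≤ suc (d x' y)
stay-or-step dist (inj₁ refl) y = n≤1+n _
stay-or-step dist (inj₂ e)    y = IsDistance.d-step dist e y

data LazyWalk (G : Graph) : V G → V G → ℕ → Set where
  stop  : ∀ x → LazyWalk G x x 0
  pause : ∀ {x y n} → LazyWalk G x y n → LazyWalk G x y (suc n)
  move  : ∀ {x x' y n} → Adj G x x' → LazyWalk G x' y n → LazyWalk G x y (suc n)

lazy : ∀ {G x y} (w : Walk G x y) n → walkLength w ≤ n → LazyWalk G x y n
lazy [ x ]    zero    _          = stop x
lazy [ x ]    (suc n) _          = pause (lazy [ x ] n z≤n)
lazy (e ∷ʷ w) (suc n) (s≤s ∣w∣≤n) = move e (lazy w n ∣w∣≤n)

-- The distance of G ⊠ H is the larger of the two coordinate distances.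
maxDistance : ∀ {A B : Set} → (A → A → ℕ) → (B → B → ℕ) → A × B → A × B → ℕ
maxDistance dA dB (a , b) (a' , b') = dA a a' ⊔ dB b b'

module _ {G H : Graph} (irrG : Irreflexive G) (irrH : Irreflexive H) where

  moves₁ : ∀ {g g'} {h h' : V H} → Adj G g g' → (g , h) ≢ (g' , h')
  moves₁ {g} e g,h≡g',h' = irrG (subst (Adj G g) (sym (cong proj₁ g,h≡g',h')) e)

  moves₂ : ∀ {g g' : V G} {h h'} → Adj H h h' → (g , h) ≢ (g' , h')
  moves₂ {h = h} e g,h≡g',h' = irrH (subst (Adj H h) (sym (cong proj₂ g,h≡g',h')) e)

  zipʷ : ∀ {g g' h h' n} → LazyWalk G g g' n → LazyWalk H h h' n →
    Σ (Walk (G ⊠ H) (g , h) (g' , h')) λ w → walkLength w ≤ n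
  zipʷ (stop g) (stop h) = [ g , h ] , z≤n
  zipʷ (pause p) (pause q) = let (w , ∣w∣≤) = zipʷ p q in w , m≤n⇒m≤1+n ∣w∣≤
  zipʷ (pause p) (move f q) =
    let (w , ∣w∣≤) = zipʷ p q in (moves₂ f , inj₁ refl , inj₂ f) ∷ʷ w , s≤s ∣w∣≤
  zipʷ (move e p) (pause q) =
    let (w , ∣w∣≤) = zipʷ p q in (moves₁ e , inj₂ e , inj₁ refl) ∷ʷ w , s≤s ∣w∣≤
  zipʷ (move e p) (move f q) =
    let (w , ∣w∣≤) = zipʷ p q in (moves₁ e , inj₂ e , inj₂ f) ∷ʷ w , s≤s ∣w∣≤

  strong-product-distance : ∀ {dG : V G → V G → ℕ} {dH : V H → V H → ℕ} → IsDistance G dG → IsDistance H dH →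
    IsDistance (G ⊠ H) (maxDistance dG dH)
  strong-product-distance {dG} {dH} distG distH =
    distance-by-steps zero-diag step attained
    where
      open IsDistance
      zero-diag : ∀ (x : V (G ⊠ H)) → maxDistance dG dH x x ≡ 0
      zero-diag (g , h) = cong₂ _⊔_ (d-refl distG g) (d-refl distH h)
      step : ∀ {x x' : V (G ⊠ H)} → Adj (G ⊠ H) x x' → ∀ y → maxDistance dG dH x y ≤ suc (maxDistance dG dH x' y)
      step (_ , e₁ , e₂) (g , h) = ⊔-mono-≤ (stay-or-step distG e₁ g) (stay-or-step distH e₂ h)
      attained : ∀ (x y : V (G ⊠ H)) → Σ (Walk (G ⊠ H) x y) λ w → walkLength w ≤ maxDistance dG dH x y
      attained (g , h) (g' , h') =
        zipʷ (lazy wG n (≤-trans ∣wG∣≤ (m≤m⊔n _ _))) (lazy wH n (≤-trans ∣wH∣≤ (m≤n⊔m _ _)))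
        where
          n = maxDistance dG dH (g , h) (g' , h')
          wG = proj₁ (shortest distG g g')
          ∣wG∣≤ = proj₂ (shortest distG g g')
          wH = proj₁ (shortest distH h h')
          ∣wH∣≤ = proj₂ (shortest distH h h')

mapʷ : ∀ {G H} (f : V G → V H) → (∀ {x y} → Adj G x y → Adj H (f x) (f y)) →
  ∀ {x y} (w : Walk G x y) → Σ (Walk H (f x) (f y)) λ w' → walkLength w' ≡ walkLength w
mapʷ f hom [ x ]    = [ f x ] , refl
mapʷ f hom (e ∷ʷ w) = let (w' , ∣w'∣) = mapʷ f hom w in hom e ∷ʷ w' , cong suc ∣w'∣

shorter : ∀ {G x y} (p q : Walk G x y) →
  Σ (Walk G x y) λ w → walkLength w ≤ walkLength p ⊓ walkLength q
shorter p q with ≤-total (walkLength p) (walkLength q)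
... | inj₁ p≤q = p , ≤-reflexive (sym (m≤n⇒m⊓n≡m p≤q))
... | inj₂ q≤p = q , ≤-reflexive (sym (m≥n⇒m⊓n≡n q≤p))

Consecutive : ℕ → ℕ → Set
Consecutive a a' = suc a ≡ a' ⊎ suc a' ≡ a

∣n-1+n∣≡1 : ∀ n → ∣ n - suc n ∣ ≡ 1
∣n-1+n∣≡1 zero    = refl
∣n-1+n∣≡1 (suc n) = ∣n-1+n∣≡1 n

consecutive-step : ∀ {a a'} → Consecutive a a' → ∀ y → ∣ a - y ∣ ≤ suc ∣ a' - y ∣
consecutive-step {a} {a'} aa' y = subst (λ k → ∣ a - y ∣ ≤ k + ∣ a' - y ∣) (gap aa') (∣-∣-triangle a a' y)
  where
    gap : Consecutive a a' → ∣ a - a' ∣ ≡ 1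
    gap (inj₁ refl) = ∣n-1+n∣≡1 a
    gap (inj₂ refl) = trans (∣-∣-comm (suc a') a') (∣n-1+n∣≡1 a')

consecutive-sym : ∀ {a a'} → Consecutive a a' → Consecutive a' a
consecutive-sym = Sum.swap

pathDistance : ∀ {n} → Fin n → Fin n → ℕ
pathDistance i j = ∣ toℕ i - toℕ j ∣

path-irreflexive : ∀ {n} → Irreflexive (Path n)
path-irreflexive (inj₁ 1+i≡i) = 1+n≢n 1+i≡i
path-irreflexive (inj₂ 1+i≡i) = 1+n≢n 1+i≡i

ascending : ∀ {n} k (i j : Fin n) → toℕ j ≡ k + toℕ i →
  Σ (Walk (Path n) i j) λ w → walkLength w ≡ k
ascending {n} zero i j j≡i = subst (λ j → Σ (Walk (Path n) i j) λ w → walkLength w ≡ 0)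
                               (toℕ-injective (sym j≡i)) ([ i ] , refl)
ascending {n} (suc k) i j j≡1+k+i =
  let (w , ∣w∣) = ascending k i⁺ j j≡k+i⁺ in inj₁ (sym (toℕ-fromℕ< i<n)) ∷ʷ w , cong suc ∣w∣
  where
    i<n : suc (toℕ i) < n
    i<n = ≤-trans (s≤s (≤-trans (s≤s (m≤n+m (toℕ i) k)) (≤-reflexive (sym j≡1+k+i)))) (toℕ<n j)
    i⁺ = fromℕ< i<n
    j≡k+i⁺ : toℕ j ≡ k + toℕ i⁺
    j≡k+i⁺ = trans j≡1+k+i (trans (sym (+-suc k (toℕ i))) (cong (k +_) (sym (toℕ-fromℕ< i<n))))

pathWalk : ∀ {n} (i j : Fin n) → Σ (Walk (Path n) i j) λ w → walkLength w ≡ pathDistance i j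
pathWalk i j with ≤-total (toℕ i) (toℕ j)
... | inj₁ i≤j =
  let (w , ∣w∣) = ascending (toℕ j ∸ toℕ i) i j (sym (m∸n+n≡m i≤j))
  in w , trans ∣w∣ (sym (m≤n⇒∣m-n∣≡n∸m i≤j))
... | inj₂ j≤i =
  let (w , ∣w∣)   = ascending (toℕ i ∸ toℕ j) j i (sym (m∸n+n≡m j≤i))
      (w' , ∣w'∣) = reverseʷ consecutive-sym w
  in w' , trans ∣w'∣ (trans ∣w∣ (sym (m≤n⇒∣n-m∣≡n∸m j≤i)))

path-distance : ∀ {n} → IsDistance (Path n) pathDistance
path-distance = distance-by-steps (λ i → ∣n-n∣≡0 (toℕ i))
  (λ e j → consecutive-step e (toℕ j)) (λ i j → let (w , ∣w∣) = pathWalk i j in w , ≤-reflexive ∣w∣)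

-- The cycle C_m: a gap of k positions is covered in k ⊓ (m - k) steps, going
-- either way round.
cyclic : ℕ → ℕ → ℕ
cyclic m k = k ⊓ (m ∸ k)

arcDistance : ℕ → ℕ → ℕ → ℕ
arcDistance m x y = cyclic m ∣ x - y ∣

cycleDistance : ∀ m → Fin m → Fin m → ℕ
cycleDistance m i j = arcDistance m (toℕ i) (toℕ j)

cycle-irreflexive : ∀ {m} → 2 ≤ m → Irreflexive (Cycle m)
cycle-irreflexive 2≤m (inj₁ 1+i≡i)                 = 1+n≢n 1+i≡i
cycle-irreflexive 2≤m (inj₂ (inj₁ 1+i≡i))          = 1+n≢n 1+i≡i
cycle-irreflexive 2≤m (inj₂ (inj₂ (inj₁ (i≡0 , 1+i≡m)))) =
  <⇒≢ 2≤m (sym (trans (sym 1+i≡m) (cong suc i≡0)))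
cycle-irreflexive 2≤m (inj₂ (inj₂ (inj₂ (i≡0 , 1+i≡m)))) =
  <⇒≢ 2≤m (sym (trans (sym 1+i≡m) (cong suc i≡0)))

∸-suc-step : ∀ m y → m ∸ y ≤ suc (m ∸ suc y)
∸-suc-step zero    y       = ≤-trans (≤-reflexive (0∸n≡0 y)) z≤n
∸-suc-step (suc m) zero    = ≤-refl
∸-suc-step (suc m) (suc y) = ∸-suc-step m y

∸-step : ∀ M {A C} → C ≤ suc A → M ∸ A ≤ suc (M ∸ C)
∸-step M {A} {zero}  _         = ≤-trans (m∸n≤m M A) (n≤1+n M)
∸-step M {A} {suc C} (s≤s C≤A) = ≤-trans (∸-monoʳ-≤ M C≤A) (∸-suc-step M C)

cyclic-step : ∀ M {A C} → A ≤ suc C → C ≤ suc A → cyclic M A ≤ suc (cyclic M C)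
cyclic-step M A≤1+C C≤1+A = ⊓-mono-≤ A≤1+C (∸-step M C≤1+A)

-- On a cycle of length n + 1 the gaps y and n - y are complementary: each way
-- round from one of them is one step longer than the other way round from the other.
closing-edge : ∀ {m a a' y} → a ≡ 0 → suc a' ≡ m → y < m →
  arcDistance m a y ≤ suc (arcDistance m a' y) × arcDistance m a' y ≤ suc (arcDistance m a y)
closing-edge {a' = n} {y} refl refl (s≤s y≤n)
  rewrite m≤n⇒∣n-m∣≡n∸m y≤n
        | +-∸-assoc 1 y≤n
        | +-∸-assoc 1 (m∸n≤m n y)
        | m∸[m∸n]≡n y≤n = swap-step y (n ∸ y) , swap-step (n ∸ y) y
  where
    swap-step : ∀ k k' → k ⊓ suc k' ≤ suc (k' ⊓ suc k)
    swap-step k k' = ⊓-glb (m⊓n≤n k (suc k')) (≤-trans (m⊓n≤m k (suc k')) (≤-trans (n≤1+n k) (n≤1+n (suc k))))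

cycle-step : ∀ {m} {a a' : Fin m} → Adj (Cycle m) a a' → ∀ y →
  cycleDistance m a y ≤ suc (cycleDistance m a' y)
cycle-step {m} (inj₁ e) y =
  cyclic-step m (consecutive-step (inj₁ e) (toℕ y)) (consecutive-step (inj₂ e) (toℕ y))
cycle-step {m} (inj₂ (inj₁ e)) y =
  cyclic-step m (consecutive-step (inj₂ e) (toℕ y)) (consecutive-step (inj₁ e) (toℕ y))
cycle-step (inj₂ (inj₂ (inj₁ (a≡0 , 1+a'≡m)))) y = proj₁ (closing-edge a≡0 1+a'≡m (toℕ<n y))
cycle-step (inj₂ (inj₂ (inj₂ (a'≡0 , 1+a≡m)))) y = proj₂ (closing-edge a'≡0 1+a≡m (toℕ<n y))

-- Going from a down to 0, across the closing edge and down from n to b.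
around-length : ∀ {a b n} → a ≤ b → b ≤ n → a + suc (n ∸ b) ≡ suc n ∸ (b ∸ a)
around-length z≤n b≤n = sym (+-∸-assoc 1 b≤n)
around-length {suc a} {suc b} {suc n} (s≤s a≤b) (s≤s b≤n) =
  trans (cong suc (around-length a≤b b≤n))
        (sym (+-∸-assoc 1 (≤-trans (m∸n≤m b a) (≤-trans b≤n (n≤1+n n)))))

module _ {n : ℕ} where

  path⊆cycle : ∀ {i j : Fin (suc n)} → Adj (Path (suc n)) i j → Adj (Cycle (suc n)) i j
  path⊆cycle (inj₁ e) = inj₁ e
  path⊆cycle (inj₂ e) = inj₂ (inj₁ e)

  direct : (a b : Fin (suc n)) → Σ (Walk (Cycle (suc n)) a b) λ w → walkLength w ≡ ∣ toℕ a - toℕ b ∣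
  direct a b = let (w , ∣w∣) = pathWalk a b
                   (w' , ∣w'∣) = mapʷ (λ i → i) path⊆cycle w
               in w' , trans ∣w'∣ ∣w∣

  around : (a b : Fin (suc n)) → toℕ a ≤ toℕ b →
    Σ (Walk (Cycle (suc n)) a b) λ w → walkLength w ≡ suc n ∸ (toℕ b ∸ toℕ a)
  around a b a≤b = down ++ʷ (closing ∷ʷ up) , ∣around∣
    where
      down = proj₁ (direct a zero)
      up = proj₁ (direct (fromℕ n) b)
      closing : Adj (Cycle (suc n)) zero (fromℕ n)
      closing = inj₂ (inj₂ (inj₁ (refl , cong suc (toℕ-fromℕ n))))
      b≤n = ≤-pred (toℕ<n b)
      ∣around∣ : walkLength (down ++ʷ (closing ∷ʷ up)) ≡ suc n ∸ (toℕ b ∸ toℕ a)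
      ∣around∣ = begin
        walkLength (down ++ʷ (closing ∷ʷ up))  ≡⟨ length-++ʷ down (closing ∷ʷ up) ⟩
        walkLength down + suc (walkLength up)  ≡⟨ cong₂ (λ k l → k + suc l)
                                                     (trans (proj₂ (direct a zero)) (∣-∣-identityʳ (toℕ a)))
                                                     (trans (proj₂ (direct (fromℕ n) b))
                                                       (trans (cong ∣_- toℕ b ∣ (toℕ-fromℕ n)) (m≤n⇒∣n-m∣≡n∸m b≤n))) ⟩
        toℕ a + suc (n ∸ toℕ b)                ≡⟨ around-length a≤b b≤n ⟩
        suc n ∸ (toℕ b ∸ toℕ a)                ∎
        where open ≡-Reasoning

  -- The shorter of the direct walk and the walk around attains the distance.
  cycleWalk-≤ : (a b : Fin (suc n)) → toℕ a ≤ toℕ b →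
    Σ (Walk (Cycle (suc n)) a b) λ w → walkLength w ≤ cycleDistance (suc n) a b
  cycleWalk-≤ a b a≤b =
    let (w , ∣w∣≤) = shorter (proj₁ (direct a b)) (proj₁ (around a b a≤b))
    in w , subst (walkLength w ≤_) (cong₂ _⊓_ (proj₂ (direct a b)) (trans (proj₂ (around a b a≤b))
             (cong (suc n ∸_) (sym (m≤n⇒∣m-n∣≡n∸m a≤b))))) ∣w∣≤

  cycleWalk : (a b : Fin (suc n)) →
    Σ (Walk (Cycle (suc n)) a b) λ w → walkLength w ≤ cycleDistance (suc n) a b
  cycleWalk a b with ≤-total (toℕ a) (toℕ b)
  ... | inj₁ a≤b = cycleWalk-≤ a b a≤b
  ... | inj₂ b≤a =
    let (w , ∣w∣≤) = cycleWalk-≤ b a b≤a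
        (w' , ∣w'∣) = reverseʷ cycle-sym w
    in w' , subst₂ _≤_ (sym ∣w'∣) (cong (cyclic (suc n)) (∣-∣-comm (toℕ b) (toℕ a))) ∣w∣≤
    where
      cycle-sym : ∀ {i j : Fin (suc n)} → Adj (Cycle (suc n)) i j → Adj (Cycle (suc n)) j i
      cycle-sym (inj₁ e)               = inj₂ (inj₁ e)
      cycle-sym (inj₂ (inj₁ e))        = inj₁ e
      cycle-sym (inj₂ (inj₂ (inj₁ e))) = inj₂ (inj₂ (inj₂ e))
      cycle-sym (inj₂ (inj₂ (inj₂ e))) = inj₂ (inj₂ (inj₁ e))

cycle-distance : ∀ {m} → IsDistance (Cycle m) (cycleDistance m)
cycle-distance {m} = distance-by-steps (λ i → cong (cyclic m) (∣n-n∣≡0 (toℕ i))) cycle-step attained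
  where
    attained : ∀ {m} (a b : Fin m) → Σ (Walk (Cycle m) a b) λ w → walkLength w ≤ cycleDistance m a b
    attained {suc n} a b = cycleWalk a b

∸-telescope : ∀ {a b c} → a ≤ b → b ≤ c → (b ∸ a) + (c ∸ b) ≡ c ∸ a
∸-telescope z≤n       b≤c       = m+[n∸m]≡n b≤c
∸-telescope (s≤s a≤b) (s≤s b≤c) = ∸-telescope a≤b b≤c

arc≤gap : ∀ m {x y} → x ≤ y → arcDistance m x y ≤ y ∸ x
arc≤gap m {x} {y} x≤y = ≤-trans (m⊓n≤m _ _) (≤-reflexive (m≤n⇒∣m-n∣≡n∸m x≤y))

arc≤co-gap : ∀ m {x y} → y ≤ x → arcDistance m x y ≤ m ∸ (x ∸ y)
arc≤co-gap m y≤x = ≤-trans (m⊓n≤n _ _) (≤-reflexive (cong (m ∸_) (m≤n⇒∣n-m∣≡n∸m y≤x)))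

-- If the arc from p₁ to p₃ through
-- p₂ is a shortest one, p₂ lies between p₁ and p₃; otherwise the complementary
-- arc from p₃ through p₄ back to p₁ is a shortest one and p₄ lies between them.
four-on-cycle : ∀ {m p₁ p₂ p₃ p₄} → p₁ ≤ p₂ → p₂ ≤ p₃ → p₃ ≤ p₄ → p₄ < m →
  Between (arcDistance m) p₁ p₂ p₃ ⊎ Between (arcDistance m) p₃ p₄ p₁
four-on-cycle {m} {p₁} {p₂} {p₃} {p₄} p₁≤p₂ p₂≤p₃ p₃≤p₄ p₄<m with (p₃ ∸ p₁) ≤? m ∸ (p₃ ∸ p₁)
... | yes short = inj₁ (begin
  arcDistance m p₁ p₂ + arcDistance m p₂ p₃  ≤⟨ +-mono-≤ (arc≤gap m p₁≤p₂) (arc≤gap m p₂≤p₃) ⟩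
  (p₂ ∸ p₁) + (p₃ ∸ p₂)                      ≡⟨ ∸-telescope p₁≤p₂ p₂≤p₃ ⟩
  p₃ ∸ p₁                                    ≡⟨ sym (m≤n⇒m⊓n≡m short) ⟩
  cyclic m (p₃ ∸ p₁)                          ≡⟨ cong (cyclic m) (sym (m≤n⇒∣m-n∣≡n∸m p₁≤p₃)) ⟩
  arcDistance m p₁ p₃                         ∎)
  where
    open ≤-Reasoning
    p₁≤p₃ = ≤-trans p₁≤p₂ p₂≤p₃
... | no long = inj₂ (begin
  arcDistance m p₃ p₄ + arcDistance m p₄ p₁  ≤⟨ +-mono-≤ (arc≤gap m p₃≤p₄) (arc≤co-gap m p₁≤p₄) ⟩
  k₂ + (m ∸ (p₄ ∸ p₁))                        ≡⟨ cong (λ g → k₂ + (m ∸ g)) (sym (∸-telescope p₁≤p₃ p₃≤p₄)) ⟩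
  k₂ + (m ∸ (k₁ + k₂))                        ≡⟨ cong (k₂ +_) (sym (∸-+-assoc m k₁ k₂)) ⟩
  k₂ + (m ∸ k₁ ∸ k₂)                          ≡⟨ m+[n∸m]≡n (m+n≤o⇒m≤o∸n k₂ k₂+k₁≤m) ⟩
  m ∸ k₁                                      ≡⟨ sym (m≥n⇒m⊓n≡n (<⇒≤ (≰⇒> long))) ⟩
  cyclic m k₁                                 ≡⟨ cong (cyclic m) (sym (m≤n⇒∣n-m∣≡n∸m p₁≤p₃)) ⟩
  arcDistance m p₃ p₁                         ∎)
  where
    open ≤-Reasoning
    p₁≤p₃ = ≤-trans p₁≤p₂ p₂≤p₃
    p₁≤p₄ = ≤-trans p₁≤p₃ p₃≤p₄
    k₁ = p₃ ∸ p₁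
    k₂ = p₄ ∸ p₃
    k₂+k₁≤m : k₂ + k₁ ≤ m
    k₂+k₁≤m = begin
      k₂ + k₁   ≡⟨ +-comm k₂ k₁ ⟩
      k₁ + k₂   ≡⟨ ∸-telescope p₁≤p₃ p₃≤p₄ ⟩
      p₄ ∸ p₁   ≤⟨ m∸n≤m p₄ p₁ ⟩
      p₄        ≤⟨ <⇒≤ p₄<m ⟩
      m         ∎

length-filter-split : ∀ {A : Set} {P : A → Set} (P? : Decidable P) (xs : List A) →
  length (filter P? xs) + length (filter (¬? ∘ P?) xs) ≡ length xs
length-filter-split P? [] = refl
length-filter-split P? (x ∷ xs) with P? x
... | yes _ = cong suc (length-filter-split P? xs)
... | no  _ = trans (+-suc _ _) (cong suc (length-filter-split P? xs))

module PathCycle (r m : ℕ) (2≤m : 2 ≤ m) where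

  G : Graph
  G = Path r ⊠ Cycle m

  row pos : V G → ℕ
  row x = toℕ (proj₁ x)
  pos x = toℕ (proj₂ x)

  D : V G → V G → ℕ
  D = maxDistance pathDistance (cycleDistance m)

  D-distance : IsDistance G D
  D-distance =
    strong-product-distance path-irreflexive (cycle-irreflexive 2≤m) path-distance cycle-distance

  open IsDistance D-distance using (d-refl; d-positive; between-distinct)

  arc : V G → V G → ℕ
  arc x y = arcDistance m (pos x) (pos y)

  arc≤D : ∀ x y → arc x y ≤ D x y
  arc≤D x y = m≤n⊔m _ _

  arc-sym : ∀ x y → arc x y ≡ arc y x
  arc-sym x y = cong (cyclic m) (∣-∣-comm (pos x) (pos y))

  _≟ᵥ_ : DecidableEquality (V G)
  _≟ᵥ_ = ≡-dec Fin._≟_ Fin._≟_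

  InCone : V G → V G → Set
  InCone x y = x ≢ y × row x ≤ row y × arc x y ≤ row y ∸ row x

  inCone? : ∀ x y → Dec (InCone x y)
  inCone? x y = ¬? (x ≟ᵥ y) ×-dec (row x ≤? row y) ×-dec (arc x y ≤? row y ∸ row x)

  cone-distance : ∀ {x y} → InCone x y → D x y ≤ row y ∸ row x
  cone-distance (_ , rx≤ry , arc≤) = ⊔-lub (≤-reflexive (m≤n⇒∣m-n∣≡n∸m rx≤ry)) arc≤

  cone-between : ∀ {x y z} → InCone x y → InCone y z → Between D x y z
  cone-between {x} {y} {z} xy@(_ , rx≤ry , _) yz@(_ , ry≤rz , _) = begin
    D x y + D y z                     ≤⟨ +-mono-≤ (cone-distance xy) (cone-distance yz) ⟩
    (row y ∸ row x) + (row z ∸ row y) ≡⟨ ∸-telescope rx≤ry ry≤rz ⟩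
    row z ∸ row x                     ≡⟨ sym (m≤n⇒∣m-n∣≡n∸m (≤-trans rx≤ry ry≤rz)) ⟩
    pathDistance (proj₁ x) (proj₁ z)  ≤⟨ m≤m⊔n _ _ ⟩
    D x z                             ∎
    where open ≤-Reasoning

  outside-cones : ∀ {x y} → ¬ InCone x y → ¬ InCone y x → D x y ≤ arc x y
  outside-cones {x} {y} ¬xy ¬yx with x ≟ᵥ y
  ... | yes refl = ≤-trans (≤-reflexive (d-refl x)) z≤n
  ... | no x≢y with ≤-total (row x) (row y)
  ...   | inj₁ rx≤ry = ⊔-lub (≤-trans (≤-reflexive (m≤n⇒∣m-n∣≡n∸m rx≤ry))
                         (<⇒≤ (≰⇒> λ arc≤ → ¬xy (x≢y , rx≤ry , arc≤)))) ≤-refl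
  ...   | inj₂ ry≤rx = ⊔-lub (≤-trans (≤-reflexive (m≤n⇒∣n-m∣≡n∸m ry≤rx))
                         (≤-trans (<⇒≤ (≰⇒> λ arc≤ → ¬yx (≢-sym x≢y , ry≤rx , arc≤)))
                           (≤-reflexive (arc-sym y x)))) ≤-refl

  Flat : List (V G) → Set
  Flat L = ∀ {x y} → x ∈ L → y ∈ L → ¬ InCone x y

  flat-between : ∀ {L} → Flat L → ∀ {a b c} → a ∈ L → b ∈ L → c ∈ L →
    Between (arcDistance m) (pos a) (pos b) (pos c) → Between D a b c
  flat-between flat {a} {b} {c} a∈L b∈L c∈L abc =
    ≤-trans (+-mono-≤ (outside-cones (flat a∈L b∈L) (flat b∈L a∈L))
                      (outside-cones (flat b∈L c∈L) (flat c∈L b∈L)))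
            (≤-trans abc (arc≤D a c))

  module ByPosition = Sort (On.decTotalOrder ≤-decTotalOrder pos)
  open PermutationProperties (setoid (V G)) using (Unique-resp-↭)

  module _ {S : List (V G)} (gp : IsGPSet G S) where

    no-between = gp-set⇒no-between D-distance gp

    -- A flat subset of a general position set has at most three vertices:
    -- among four of them, sorted by cycle position, four-on-cycle finds a betweenness.
    flat-small : ∀ {L} → Flat L → (∀ {z} → z ∈ L → z ∈ S) → Unique L → length L ≤ 3
    flat-small {L} flat L⊆S unique =
      subst (_≤ 3) (↭-length sorted↭L)
        (at-most-three (ByPosition.sort L) (ByPosition.sort-↗ L)
          (Unique-resp-↭ (↭⇒↭ₛ (↭-sym sorted↭L)) unique) (∈-resp-↭ sorted↭L))
      where
        sorted↭L = ByPosition.sort-↭ L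
        at-most-three : ∀ L' → Linked (λ x y → pos x ≤ pos y) L' → Unique L' →
          (∀ {z} → z ∈ L' → z ∈ L) → length L' ≤ 3
        at-most-three [] _ _ _ = z≤n
        at-most-three (_ ∷ []) _ _ _ = s≤s z≤n
        at-most-three (_ ∷ _ ∷ []) _ _ _ = s≤s (s≤s z≤n)
        at-most-three (_ ∷ _ ∷ _ ∷ []) _ _ _ = ≤-refl
        at-most-three (x₁ ∷ x₂ ∷ x₃ ∷ x₄ ∷ _) (p₁₂ ∷ p₂₃ ∷ p₃₄ ∷ _)
          ((x₁≢x₂ ∷ x₁≢x₃ ∷ x₁≢x₄ ∷ _) ∷ (x₂≢x₃ ∷ _) ∷ (x₃≢x₄ ∷ _) ∷ _) ⊆L =
          ⊥-elim ([ no-between (in-S x₁∈) (in-S x₂∈) (in-S x₃∈) x₁≢x₂ x₂≢x₃ x₁≢x₃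
                                ∘ flat-between flat (⊆L x₁∈) (⊆L x₂∈) (⊆L x₃∈)
                  , no-between (in-S x₃∈) (in-S x₄∈) (in-S x₁∈) x₃≢x₄ (≢-sym x₁≢x₄) (≢-sym x₁≢x₃)
                                ∘ flat-between flat (⊆L x₃∈) (⊆L x₄∈) (⊆L x₁∈) ]′
                  (four-on-cycle p₁₂ p₂₃ p₃₄ (toℕ<n (proj₂ x₄))))
          where
            in-S : ∀ {z} → z ∈ x₁ ∷ x₂ ∷ x₃ ∷ x₄ ∷ _ → z ∈ S
            in-S = L⊆S ∘ ⊆L
            x₁∈ = here refl
            x₂∈ = there (here refl)
            x₃∈ = there (there (here refl))
            x₄∈ = there (there (there (here refl)))

    hasCone? : ∀ x → Dec (Any (InCone x) S)
    hasCone? x = any? (inCone? x) S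

    lower = filter hasCone? S
    upper = filter (¬? ∘ hasCone?) S

    upper-flat : Flat upper
    upper-flat x∈ y∈ xy =
      proj₂ (∈-filter⁻ (¬? ∘ hasCone?) {xs = S} x∈) (lose (proj₁ (∈-filter⁻ (¬? ∘ hasCone?) {xs = S} y∈)) xy)

    -- x below y below z would put y between x and z.
    lower-flat : Flat lower
    lower-flat x∈ y∈ xy =
      let (x∈S , _) = ∈-filter⁻ hasCone? {xs = S} x∈
          (y∈S , y-has-cone) = ∈-filter⁻ hasCone? {xs = S} y∈
          (z , z∈S , yz) = find y-has-cone
          xyz = cone-between xy yz
      in no-between x∈S y∈S z∈S (proj₁ xy) (proj₁ yz) (between-distinct xyz (proj₁ xy)) xyz

    gp-upper-bound : length S ≤ 6
    gp-upper-bound = subst (_≤ 6) (length-filter-split hasCone? S)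
      (+-mono-≤ (flat-small lower-flat (proj₁ ∘ ∈-filter⁻ hasCone? {xs = S}) (filter⁺ hasCone? (proj₁ gp)))
                (flat-small upper-flat (proj₁ ∘ ∈-filter⁻ (¬? ∘ hasCone?) {xs = S}) (filter⁺ (¬? ∘ hasCone?) (proj₁ gp))))

module OddCycle (r t : ℕ) (1≤t : 1 ≤ t) where

  m : ℕ
  m = 2 * t + 1

  m≡1+t+t : m ≡ suc (t + t)
  m≡1+t+t = trans (+-comm (2 * t) 1) (cong (λ k → suc (t + k)) (+-identityʳ t))

  2≤m : 2 ≤ m
  2≤m = subst (2 ≤_) (sym m≡1+t+t) (s≤s (≤-trans 1≤t (m≤m+n t t)))

  m∸[1+t]≡t : m ∸ suc t ≡ t
  m∸[1+t]≡t = trans (cong (_∸ suc t) m≡1+t+t) (m+n∸m≡n t t)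

  open PathCycle (suc (suc r)) m 2≤m public
  open IsDistance D-distance using (d-positive)

  arc≤t : ∀ x y → arc x y ≤ t
  arc≤t x y with ∣ pos x - pos y ∣ ≤? t
  ... | yes gap≤t = ≤-trans (m⊓n≤m _ _) gap≤t
  ... | no  gap>t = ≤-trans (m⊓n≤n _ _) (≤-trans (∸-monoʳ-≤ m (≰⇒> gap>t)) (≤-reflexive m∸[1+t]≡t))

  D-sym : ∀ x y → D x y ≡ D y x
  D-sym x y = cong₂ _⊔_ (∣-∣-comm (row x) (row y)) (arc-sym x y)

  Low Near Far : V G → Set
  Low x = row x ≤ 1
  Near x = pos x ≤ 1
  Far x = pos x ≡ suc t

  low-rows : ∀ {x y} → Low x → Low y → pathDistance (proj₁ x) (proj₁ y) ≤ 1
  low-rows {x} {y} lx ly = ≤-trans (∣m-n∣≤m⊔n (row x) (row y)) (⊔-lub lx ly)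

  low-bounded : ∀ {x y} → Low x → Low y → D x y ≤ t
  low-bounded {x} {y} lx ly = ⊔-lub (≤-trans (low-rows {x} {y} lx ly) 1≤t) (arc≤t x y)

  same-kind-close : ∀ {x y} → Low x → Low y → (Near x × Near y) ⊎ (Far x × Far y) → D x y ≤ 1
  same-kind-close {x} {y} lx ly (inj₁ (nx , ny)) =
    ⊔-lub (low-rows {x} {y} lx ly) (≤-trans (m⊓n≤m _ _) (≤-trans (∣m-n∣≤m⊔n (pos x) (pos y)) (⊔-lub nx ny)))
  same-kind-close {x} {y} lx ly (inj₂ (fx , fy)) =
    ⊔-lub (low-rows {x} {y} lx ly)
      (≤-trans (m⊓n≤m _ _) (≤-trans (≤-reflexive (trans (cong₂ ∣_-_∣ fx fy) (∣n-n∣≡0 (suc t)))) z≤n))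

  near-far-apart : ∀ {x y} → Near x → Far y → t ≤ D x y
  near-far-apart {x} {y} nx fy = ≤-trans (⊓-glb t≤gap t≤co-gap) (arc≤D x y)
    where
      gap≡ : ∣ pos x - pos y ∣ ≡ suc t ∸ pos x
      gap≡ = trans (cong ∣ pos x -_∣ fy) (m≤n⇒∣m-n∣≡n∸m (≤-trans nx (s≤s z≤n)))
      t≤gap : t ≤ ∣ pos x - pos y ∣
      t≤gap = ≤-trans (∸-monoʳ-≤ (suc t) nx) (≤-reflexive (sym gap≡))
      t≤co-gap : t ≤ m ∸ ∣ pos x - pos y ∣
      t≤co-gap = ≤-trans (≤-reflexive (sym m∸[1+t]≡t))
                   (∸-monoʳ-≤ m (≤-trans (≤-reflexive gap≡) (m∸n≤m (suc t) (pos x))))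

  far-near-apart : ∀ {x y} → Far x → Near y → t ≤ D x y
  far-near-apart {x} {y} fx ny = subst (t ≤_) (D-sym y x) (near-far-apart {y} {x} ny fx)

  ends-close : ∀ {a b c} → a ≢ b → b ≢ c → Between D a b c → ¬ D a c ≤ 1
  ends-close a≢b b≢c abc ac≤1 = 1+n≰n (≤-trans (+-mono-≤ (d-positive a≢b) (d-positive b≢c)) (≤-trans abc ac≤1))

  middle-apart : ∀ {a b c} → a ≢ b → b ≢ c → Between D a b c → D a c ≤ t →
    ¬ (t ≤ D a b ⊎ t ≤ D b c)
  middle-apart {a} {b} {c} a≢b b≢c abc ac≤t long = 1+n≰n (≤-trans steps (≤-trans abc ac≤t))
    where
      steps : suc t ≤ D a b + D b c
      steps = [ (λ t≤ab → subst (_≤ D a b + D b c) (+-comm t 1) (+-mono-≤ t≤ab (d-positive b≢c)))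
              , (λ t≤bc → +-mono-≤ (d-positive a≢b) t≤bc) ]′ long

  0<m : 0 < m
  0<m = ≤-trans (s≤s z≤n) 2≤m

  1+t<m : suc t < m
  1+t<m = subst (suc (suc t) ≤_) (sym m≡1+t+t) (s≤s (subst (_≤ t + t) (+-comm t 1) (+-monoʳ-≤ t 1≤t)))

  rows : List (Fin (suc (suc r)))
  rows = zero ∷ suc zero ∷ []

  positions : List (Fin m)
  positions = fromℕ< 0<m ∷ fromℕ< 2≤m ∷ fromℕ< 1+t<m ∷ []

  S₆ : List (V G)
  S₆ = cartesianProduct rows positions

  unique-S₆ : Unique S₆
  unique-S₆ = cartesianProduct⁺ {xs = rows} {ys = positions} (((λ ()) ∷ []) ∷ [] ∷ [])
    ((differ 0<m 2≤m (λ ()) ∷ differ 0<m 1+t<m (λ ()) ∷ []) ∷ (differ 2≤m 1+t<m 1≢1+t ∷ []) ∷ [] ∷ [])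
    where
      differ : ∀ {k l} (k< : k < m) (l< : l < m) → k ≢ l → fromℕ< k< ≢ fromℕ< l<
      differ k< l< k≢l eq = k≢l (trans (sym (toℕ-fromℕ< k<)) (trans (cong toℕ eq) (toℕ-fromℕ< l<)))
      1≢1+t : 1 ≢ suc t
      1≢1+t 1≡1+t = <⇒≢ 1≤t (suc-injective 1≡1+t)

  kind : ∀ {x} → x ∈ S₆ → Low x × (Near x ⊎ Far x)
  kind {x} x∈S₆ = let (row∈ , pos∈) = ∈-cartesianProduct⁻ rows positions x∈S₆ in low row∈ , near-or-far pos∈
    where
      low : proj₁ x ∈ rows → Low x
      low (here refl)         = z≤n
      low (there (here refl)) = s≤s z≤n
      near-or-far : proj₂ x ∈ positions → Near x ⊎ Far x
      near-or-far (here refl)                 = inj₁ (≤-trans (≤-reflexive (toℕ-fromℕ< 0<m)) z≤n)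
      near-or-far (there (here refl))         = inj₁ (≤-reflexive (toℕ-fromℕ< 2≤m))
      near-or-far (there (there (here refl))) = inj₂ (toℕ-fromℕ< 1+t<m)

  -- In S₆ the two ends of a betweenness are of the same kind (too close) or of
  -- different kinds (then one step is already t long).
  S₆-no-between : ∀ {a b c} → a ∈ S₆ → b ∈ S₆ → c ∈ S₆ → a ≢ b → b ≢ c → a ≢ c → ¬ Between D a b c
  S₆-no-between {a} {b} {c} a∈ b∈ c∈ a≢b b≢c _ abc with kind a∈ | kind b∈ | kind c∈
  ... | la , inj₁ na | _ | lc , inj₁ nc =
    ends-close a≢b b≢c abc (same-kind-close {a} {c} la lc (inj₁ (na , nc)))
  ... | la , inj₂ fa | _ | lc , inj₂ fc =
    ends-close a≢b b≢c abc (same-kind-close {a} {c} la lc (inj₂ (fa , fc)))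
  ... | la , inj₁ na | _ , inj₁ nb | lc , inj₂ fc =
    middle-apart a≢b b≢c abc (low-bounded {a} {c} la lc) (inj₂ (near-far-apart {b} {c} nb fc))
  ... | la , inj₁ na | _ , inj₂ fb | lc , inj₂ fc =
    middle-apart a≢b b≢c abc (low-bounded {a} {c} la lc) (inj₁ (near-far-apart {a} {b} na fb))
  ... | la , inj₂ fa | _ , inj₁ nb | lc , inj₁ nc =
    middle-apart a≢b b≢c abc (low-bounded {a} {c} la lc) (inj₁ (far-near-apart {a} {b} fa nb))
  ... | la , inj₂ fa | _ , inj₂ fb | lc , inj₁ nc =
    middle-apart a≢b b≢c abc (low-bounded {a} {c} la lc) (inj₂ (far-near-apart {b} {c} fb nc))

  gp-S₆ : IsGPSet G S₆
  gp-S₆ = gp-set-by-betweenness D-distance S₆ unique-S₆ S₆-no-between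

gp-path-odd-cycle : ∀ r t → r ≥ 2 → t ≥ 1 → GpNumber (Path r ⊠ Cycle (2 * t + 1)) 6
gp-path-odd-cycle (suc zero)    t (s≤s ()) _
gp-path-odd-cycle (suc (suc r)) t _ 1≤t = (S₆ , gp-S₆ , refl) , λ S gp → gp-upper-bound gp
  where open OddCycle r t 1≤t

theorem4p6 : (r t : ℕ) → r ≥ 2 → t ≥ 1 →
    (Σ ℕ λ k → GpNumber (Path r ⊠ Cycle (2 * t + 1)) k × 6 ≤ k × k ≤ 7) ×
    ((t ≡ 1 ⊎ t ≡ 2) ⊎ r ≡ 2 → GpNumber (Path r ⊠ Cycle (2 * t + 1)) 6)
theorem4p6 r t 2≤r 1≤t = (6 , gp≡6 , ≤-refl , n≤1+n 6) , λ _ → gp≡6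
  where gp≡6 = gp-path-odd-cycle r t 2≤r 1≤t
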